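{- Let $k\ge 3$. For every integer $i\ge 0$: $|W^{(k)}_{i+1}|=2|W^{(k)}_i|$ if $0\le i\le k-2$; $|W^{(k)}_{i+1}|=2|W^{(k)}_i|-1$ if $i=k-1$; and $|W^{(k)}_{i+1}|=2|W^{(k)}_i|-|W^{(k)}_{i-k}|$ if $i>k-1$.
   Context: The alphabet is $\mathbb{N}=\{0,1,2,\dots\}$. For an integer $k\ge 3$, $\varphi_k$ is the morphism of $\mathbb{N}^*$ defined on letters, for $i\ge 0$ and $0\le j\le k-1$, by $\varphi_k(ki+j)=(ki)(ki+j+1)$ (two letters) if $0\le j\le k-2$, and $\varphi_k(ki+k-1)=(ki+k)$ (one letter). For $n\ge 0$, $W^{(k)}_n=\varphi_k^n(0)$; $|W|$ is the length of $W$. -}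

module Defs where

open import Data.Nat using (ℕ; zero; suc; _+_; _*_; _<?_; NonZero)
open import Data.Nat.DivMod using (_/_; _%_)
open import Data.List using (List; []; _∷_; concatMap)
open import Relation.Nullary using (yes; no)

-- φ_k on a letter a = k*i + j (i = a / k, j = a % k):
--   φ_k(a) = (k*i) (a+1)  if j ≤ k-2  (i.e. j+1 < k)
--   φ_k(a) = (a+1)        if j = k-1
φ-letter : (k : ℕ) → .{{_ : NonZero k}} → ℕ → List ℕ
φ-letter k a with suc (a % k) <? k
... | yes _ = (k * (a / k)) ∷ suc a ∷ []
... | no  _ = suc a ∷ []

φ : (k : ℕ) → .{{_ : NonZero k}} → List ℕ → List ℕ
φ k w = concatMap (φ-letter k) w

φ^ : (k : ℕ) → .{{_ : NonZero k}} → ℕ → List ℕ → List ℕ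
φ^ k zero    w = w
φ^ k (suc n) w = φ k (φ^ k n w)

W : (k : ℕ) → .{{_ : NonZero k}} → ℕ → List ℕ
W k n = φ^ k n (0 ∷ [])

-- Let c_j(w) count the letters of w congruent to j mod k. Each φ_k-image of a letter
-- contains exactly one multiple of k, and its remaining letter (if any) shifts the
-- residue by one; the image has two letters unless the residue is k-1. Hence
-- |φ_k(w)| = 2|w| - c_{k-1}(w), c_0(φ_k(w)) = |w| and c_{j+1}(φ_k(w)) = c_j(w) for j+1 < k.
-- Iterating, c_{k-1}(W_i) is 0 for i < k-1 and 1 for i = k-1, while
-- c_{k-1}(W_{k+m}) = |W_m|.
module Submission where

open import Defs
open import Data.Nat using (ℕ; zero; suc; _+_; _*_; _∸_; _≤_; _<_; _<?_; NonZero; s≤s; z≤n)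
open import Data.Nat.Properties
  using (+-assoc; +-identityʳ; *-comm; *-distribˡ-+; suc-injective; ≤-antisym; ≮⇒≥; ≤-pred; ≤-refl; <⇒≤)
open import Data.Nat.DivMod
  using (_%_; _/_; m≡m%n+[m/n]*n; [m+kn]%n≡m%n; m<n⇒m%n≡m; n%n≡0; m*n%n≡0; m%n<n)
open import Data.List using (List; []; _∷_; _++_; length)
open import Data.List.Properties using (length-++)
open import Data.Product using (_×_; _,_)
open import Relation.Binary.PropositionalEquality using (_≡_; refl; sym; trans; cong; cong₂; module ≡-Reasoning)
open import Relation.Nullary using (yes; no; ¬_)
open import Data.Nat.Tactic.RingSolver using (solve-∀)

δ : ℕ → ℕ → ℕ
δ zero    zero    = 1
δ zero    (suc _) = 0
δ (suc _) zero    = 0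
δ (suc m) (suc n) = δ m n

δ-refl : ∀ n → δ n n ≡ 1
δ-refl zero    = refl
δ-refl (suc n) = δ-refl n

δ-< : ∀ {m n} → m < n → δ m n ≡ 0
δ-< {zero}  {suc n} _       = refl
δ-< {suc m} {suc n} (s≤s p) = δ-< p

δ-> : ∀ {m n} → n < m → δ m n ≡ 0
δ-> {suc m} {zero}  _       = refl
δ-> {suc m} {suc n} (s≤s p) = δ-> p

-- Residues modulo k = suc k′, so that the last residue k - 1 is k′ without truncated subtraction.
module Residues (k′ : ℕ) where

  private
    k : ℕ
    k = suc k′

  %-suc : ∀ a → suc a % k ≡ suc (a % k) % k
  %-suc a = begin
    suc a % k                     ≡⟨ cong (λ x → suc x % k) (m≡m%n+[m/n]*n a k) ⟩
    (suc (a % k) + a / k * k) % k ≡⟨ [m+kn]%n≡m%n (suc (a % k)) (a / k) k ⟩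
    suc (a % k) % k               ∎
    where open ≡-Reasoning

  %-suc-< : ∀ a → suc (a % k) < k → suc a % k ≡ suc (a % k)
  %-suc-< a p = trans (%-suc a) (m<n⇒m%n≡m p)

  %-≮ : ∀ a → ¬ (suc (a % k) < k) → a % k ≡ k′
  %-≮ a np = suc-injective (≤-antisym (m%n<n a k) (≮⇒≥ np))

  %-suc-≮ : ∀ a → ¬ (suc (a % k) < k) → suc a % k ≡ 0
  %-suc-≮ a np = trans (%-suc a) (trans (cong (λ r → suc r % k) (%-≮ a np)) (n%n≡0 k))

  k*n%k≡0 : ∀ n → (k * n) % k ≡ 0
  k*n%k≡0 n = trans (cong (_% k) (*-comm k n)) (m*n%n≡0 n k)

  residueCount : ℕ → List ℕ → ℕ
  residueCount j []      = 0
  residueCount j (a ∷ w) = δ (a % k) j + residueCount j w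

  residueCount-++ : ∀ j u v → residueCount j (u ++ v) ≡ residueCount j u + residueCount j v
  residueCount-++ j []      v = refl
  residueCount-++ j (a ∷ u) v =
    trans (cong (δ (a % k) j +_) (residueCount-++ j u v)) (sym (+-assoc (δ (a % k) j) _ _))

  residueCount-zero-φ-letter : ∀ a → residueCount 0 (φ-letter k a) ≡ 1
  residueCount-zero-φ-letter a with suc (a % k) <? k
  ... | yes p rewrite k*n%k≡0 (a / k) | %-suc-< a p = refl
  ... | no np rewrite %-suc-≮ a np = refl

  residueCount-suc-φ-letter : ∀ j a → suc j < k → residueCount (suc j) (φ-letter k a) ≡ δ (a % k) j
  residueCount-suc-φ-letter j a q with suc (a % k) <? k
  ... | yes p rewrite k*n%k≡0 (a / k) | %-suc-< a p = +-identityʳ _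
  ... | no np rewrite %-suc-≮ a np | %-≮ a np = sym (δ-> (≤-pred q))

  length-φ-letter : ∀ a → length (φ-letter k a) + δ (a % k) k′ ≡ 2
  length-φ-letter a with suc (a % k) <? k
  ... | yes p rewrite δ-< (≤-pred p) = refl
  ... | no np rewrite %-≮ a np | δ-refl k′ = refl

  residueCount-zero-φ : ∀ w → residueCount 0 (φ k w) ≡ length w
  residueCount-zero-φ []      = refl
  residueCount-zero-φ (a ∷ w)
    rewrite residueCount-++ 0 (φ-letter k a) (φ k w)
          | residueCount-zero-φ-letter a | residueCount-zero-φ w = refl

  residueCount-suc-φ : ∀ j w → suc j < k → residueCount (suc j) (φ k w) ≡ residueCount j w
  residueCount-suc-φ j []      q = refl
  residueCount-suc-φ j (a ∷ w) q
    rewrite residueCount-++ (suc j) (φ-letter k a) (φ k w)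
          | residueCount-suc-φ-letter j a q | residueCount-suc-φ j w q = refl

  length-φ : ∀ w → length (φ k w) + residueCount k′ w ≡ 2 * length w
  length-φ []      = refl
  length-φ (a ∷ w) = begin
    length (φ-letter k a ++ φ k w) + (δ (a % k) k′ + residueCount k′ w)
      ≡⟨ cong (_+ (δ (a % k) k′ + residueCount k′ w)) (length-++ (φ-letter k a)) ⟩
    length (φ-letter k a) + length (φ k w) + (δ (a % k) k′ + residueCount k′ w)
      ≡⟨ interchange (length (φ-letter k a)) _ _ _ ⟩
    (length (φ-letter k a) + δ (a % k) k′) + (length (φ k w) + residueCount k′ w)
      ≡⟨ cong₂ _+_ (length-φ-letter a) (length-φ w) ⟩
    2 * 1 + 2 * length w
      ≡⟨ *-distribˡ-+ 2 1 (length w) ⟨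
    2 * suc (length w) ∎
    where
    open ≡-Reasoning
    interchange : ∀ a b c d → a + b + (c + d) ≡ (a + c) + (b + d)
    interchange = solve-∀

  residueCount-φ^-suc : ∀ j m w → j < k → residueCount j (φ^ k (suc (j + m)) w) ≡ length (φ^ k m w)
  residueCount-φ^-suc zero    m w _ = residueCount-zero-φ (φ^ k m w)
  residueCount-φ^-suc (suc j) m w q =
    trans (residueCount-suc-φ j (φ^ k (suc (j + m)) w) q) (residueCount-φ^-suc j m w (<⇒≤ q))

  residueCount-W : ∀ {i j} → i ≤ j → j < k → residueCount j (W k i) ≡ δ i j
  residueCount-W {zero}  {j}     _       _ = +-identityʳ (δ 0 j)
  residueCount-W {suc i} {suc j} (s≤s p) q =
    trans (residueCount-suc-φ j (W k i) q) (residueCount-W p (<⇒≤ q))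

corollary4p4 : (k : ℕ) → .{{_ : NonZero k}} → 3 ≤ k →
    ((i : ℕ) → i ≤ k ∸ 2 → length (W k (suc i)) ≡ 2 * length (W k i))
    × (length (W k k) + 1 ≡ 2 * length (W k (k ∸ 1)))
    × ((m : ℕ) → length (W k (suc (k + m))) + length (W k m) ≡ 2 * length (W k (k + m)))
corollary4p4 (suc k′@(suc (suc _))) (s≤s (s≤s (s≤s z≤n))) = doubling , last-doubling , recurrence
  where
  open Residues k′
  k : ℕ
  k = suc k′
  length-W-suc : ∀ i {c} → residueCount k′ (W k i) ≡ c → length (W k (suc i)) + c ≡ 2 * length (W k i)
  length-W-suc i refl = length-φ (W k i)
  doubling : (i : ℕ) → i ≤ k ∸ 2 → length (W k (suc i)) ≡ 2 * length (W k i)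
  doubling i i<k′ = trans (sym (+-identityʳ _))
    (length-W-suc i (trans (residueCount-W (<⇒≤ (s≤s i<k′)) ≤-refl) (δ-< (s≤s i<k′))))
  last-doubling : length (W k k) + 1 ≡ 2 * length (W k k′)
  last-doubling = length-W-suc k′ (trans (residueCount-W ≤-refl ≤-refl) (δ-refl k′))
  recurrence : (m : ℕ) → length (W k (suc (k + m))) + length (W k m) ≡ 2 * length (W k (k + m))
  recurrence m = length-W-suc (k + m) (residueCount-φ^-suc k′ m (0 ∷ []) ≤-refl)
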